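{- Let $\ell\ge 2$ and let $k_1,\dots,k_\ell$ be positive integers with $k=\sum_{i=1}^\ell k_i$. Let $A_{\ell,n}(m)$ be the number of words of length $n$ over $\{1,\dots,\ell\}$ containing exactly $m$ $(k_1,\dots,k_\ell)$ patterns. Then \[ \widetilde G_\ell(w,z):=\sum_{n\ge0}\sum_{m\ge0}A_{\ell,n}(m)\,w^mz^n=\frac{(1-z)^{\ell-2}}{(1-z)^{\ell-2}(1-\ell z)-(w-1)z^k}. \]
   Context: A $(k_1,\dots,k_\ell)$ pattern is an occurrence of a maximal run of at least $k_1$ consecutive $1$'s immediately followed by a maximal run of at least $k_2$ consecutive $2$'s, ..., immediately followed by a maximal run of at least $k_\ell$ consecutive $\ell$'s; patterns are counted by number of such occurrences. The empty word has $0$ patterns. -}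

module Defs where

open import Data.Nat as ℕ using (ℕ; zero; suc; _∸_; _≤?_)
open import Data.Integer as ℤ using (ℤ; +_) renaming (_+_ to _+ℤ_; _*_ to _*ℤ_; -_ to -ℤ_)
open import Data.Fin using (Fin; _≟_)
open import Data.Bool using (Bool; true; false; if_then_else_; _∧_)
open import Data.Product using (_×_; _,_)
open import Data.List using (List; []; _∷_; map; concatMap; length; filter; foldr; upTo)
open import Data.List using (allFin) public
open import Relation.Nullary using (does)

-- Letters {1,…,ℓ} are encoded as Fin ℓ (letter i+1 ↔ index i).

pushRun : {ℓ : ℕ} → Fin ℓ → List (Fin ℓ × ℕ) → List (Fin ℓ × ℕ)
pushRun a [] = (a , 1) ∷ []
pushRun a ((b , c) ∷ rs) =
  if does (a ≟ b) then (b , suc c) ∷ rs else (a , 1) ∷ (b , c) ∷ rs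

runs : {ℓ : ℕ} → List (Fin ℓ) → List (Fin ℓ × ℕ)
runs [] = []
runs (a ∷ w) = pushRun a (runs w)

prefixMatch : {ℓ : ℕ} → List (Fin ℓ × ℕ) → List (Fin ℓ × ℕ) → Bool
prefixMatch [] _ = true
prefixMatch (_ ∷ _) [] = false
prefixMatch ((a , t) ∷ ps) ((b , c) ∷ rs) =
  does (a ≟ b) ∧ (does (t ≤? c) ∧ prefixMatch ps rs)

countOcc : {ℓ : ℕ} → List (Fin ℓ × ℕ) → List (Fin ℓ × ℕ) → ℕ
countOcc p [] = 0
countOcc p (r ∷ rs) = (if prefixMatch p (r ∷ rs) then 1 else 0) ℕ.+ countOcc p rs

-- the (k₁,…,k_ℓ) pattern: maximal runs of ≥ k_i letters i, for i = 1,…,ℓ in order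
pattern' : {ℓ : ℕ} → (Fin ℓ → ℕ) → List (Fin ℓ × ℕ)
pattern' {ℓ} k = map (λ i → (i , k i)) (allFin ℓ)

patterns : {ℓ : ℕ} → (Fin ℓ → ℕ) → List (Fin ℓ) → ℕ
patterns k w = countOcc (pattern' k) (runs w)

words : (ℓ n : ℕ) → List (List (Fin ℓ))
words ℓ zero = [] ∷ []
words ℓ (suc n) = concatMap (λ a → map (a ∷_) (words ℓ n)) (allFin ℓ)

A : (ℓ : ℕ) → (Fin ℓ → ℕ) → ℕ → ℕ → ℕ
A ℓ k n m = length (filter (λ w → patterns k w ℕ.≟ m) (words ℓ n))

sumK : {ℓ : ℕ} → (Fin ℓ → ℕ) → ℕ
sumK {ℓ} k = foldr ℕ._+_ 0 (map k (allFin ℓ))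

-- Formal power series in two variables w, z over ℤ:
-- S m n = coefficient of w^m z^n.
Series : Set
Series = ℕ → ℕ → ℤ

sumℤ : List ℤ → ℤ
sumℤ = foldr _+ℤ_ (+ 0)

_⊕_ : Series → Series → Series
(f ⊕ g) m n = f m n +ℤ g m n

⊖_ : Series → Series
(⊖ f) m n = -ℤ f m n

_⊝_ : Series → Series → Series
f ⊝ g = f ⊕ (⊖ g)

_⊛_ : Series → Series → Series
(f ⊛ g) m n =
  sumℤ (map (λ i → sumℤ (map (λ j → f i j *ℤ g (m ∸ i) (n ∸ j)) (upTo (suc n)))) (upTo (suc m)))

const : ℤ → Series
const c zero zero = c
const c _ _ = + 0

oneS : Series
oneS = const (+ 1)

wS : Series
wS (suc zero) zero = + 1
wS _ _ = + 0

zS : Series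
zS zero (suc zero) = + 1
zS _ _ = + 0

_^S_ : Series → ℕ → Series
f ^S zero = oneS
f ^S suc e = f ⊛ (f ^S e)

Gtilde : (ℓ : ℕ) → (Fin ℓ → ℕ) → Series
Gtilde ℓ k m n = + A ℓ k n m

-- Prepending a letter other than 1 to a word never changes its number of patterns, and
-- 1·v has exactly one pattern more than v precisely when v starts with exactly k₁ − 1 ones
-- followed by runs of at least k₂ twos, …, at least k_ℓ letters ℓ.  Writing D for the
-- generating function of these v, this gives G̃ = 1 + z (ℓ G̃ + (w − 1) D).  Reading off the
-- prescribed runs letter by letter, a run of at least kᵢ letters i followed by a different
-- letter contributes z^kᵢ / (1 − z), and the last run z^k_ℓ times an arbitrary word, so
-- (1 − z)^(ℓ−2) D = z^(k−1) G̃.  Eliminating D gives the formula.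

module Submission where

open import Defs
open import Data.Nat using (ℕ; _≤_; _∸_)
open import Data.Integer using (+_)
open import Data.Fin using (Fin)
open import Relation.Binary.PropositionalEquality using (_≡_)

open import Algebra.Bundles using (CommutativeMonoid; CommutativeRing; RawRing)
open import Algebra.Core using (Op₁; Op₂)
open import Algebra.Solver.Ring.AlmostCommutativeRing
  using (_-Raw-AlmostCommutative⟶_; fromCommutativeRing; -raw-almostCommutative⟶)
open import Data.Bool using (Bool; true; false; if_then_else_; _∧_; _∨_)
import Data.Bool.Properties as Bool
open import Data.Fin as Fin using (toℕ; opposite)
import Data.Fin.Properties as Fin
open import Data.Fin.Permutation using (reverse)
open import Data.Integer as ℤ using (ℤ)
import Data.Integer.Properties as ℤ
open import Data.Integer.Tactic.RingSolver using (solve-∀)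
open import Data.List
  using (List; []; _∷_; _++_; map; applyUpTo; upTo; concatMap; tabulate; filter; length)
import Data.List.Properties as List
open import Data.Maybe using (Maybe; just; nothing)
open import Data.Nat as ℕ using (zero; suc; _<_; _≡ᵇ_; _<ᵇ_; z≤n; s≤s)
import Data.Nat.ListAction as ℕ using (sum)
import Data.Nat.Properties as ℕ
open import Data.Product using (_,_; _×_; ∃₂; proj₂)
open import Data.Vec.Functional using (Vector)
open import Function using (_∘_; _∘′_; id)
open import Function.Definitions using (Injective)
open import Level using (0ℓ)
open import Relation.Binary.Core using (Rel)
import Relation.Binary.PropositionalEquality as ≡
open ≡ using (_≢_)
open import Relation.Nullary using (does; yes; no; contradiction)
open import Relation.Nullary.Decidable using (dec-true; dec-false)
open import Relation.Unary using (Pred; Decidable)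

module _ {c ℓ} (M : CommutativeMonoid c ℓ) where

  open CommutativeMonoid M
  open import Algebra.Properties.CommutativeMonoid.Sum M
  open import Relation.Binary.Reasoning.Setoid setoid

  sum-supportedAt : ∀ {n} (t : Vector Carrier (suc n)) i → (∀ j → j ≢ i → t j ≈ ε) → sum t ≈ t i
  sum-supportedAt {n} t i vanishes = begin
    sum t                                 ≈⟨ sum-remove t ⟩
    t i ∙ sum (λ j → t (Fin.punchIn i j)) ≈⟨ ∙-congˡ (sum-cong-≋ {n} {t ∘′ Fin.punchIn i} vanishes′) ⟩
    t i ∙ sum {n} (λ _ → ε)               ≈⟨ ∙-congˡ (sum-replicate-zero n) ⟩
    t i ∙ ε                               ≈⟨ identityʳ (t i) ⟩
    t i                                   ∎
    where
    vanishes′ : ∀ j → t (Fin.punchIn i j) ≈ ε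
    vanishes′ j = vanishes _ (Fin.punchInᵢ≢i i j)

-- Formal power series over a commutative ring

module PowerSeries {c ℓ} (R : CommutativeRing c ℓ) where

  open CommutativeRing R
  import Algebra.Properties.Semiring.Sum
  open Algebra.Properties.Semiring.Sum semiring
  open import Algebra.Properties.Ring ring using (-0#≈0#)
  open import Relation.Binary.Reasoning.Setoid setoid
  import Algebra.Construct.Pointwise ℕ as Pointwise

  PowerSeries : Set c
  PowerSeries = ℕ → Carrier

  infix  4 _≋_
  infixl 7 _*ₛ_ _·_
  infixl 6 _+ₛ_

  _≋_ : Rel PowerSeries ℓ
  f ≋ g = ∀ n → f n ≈ g n

  _+ₛ_ : Op₂ PowerSeries
  (f +ₛ g) n = f n + g n

  -ₛ_ : Op₁ PowerSeries
  (-ₛ f) n = - f n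

  0ₛ : PowerSeries
  0ₛ _ = 0#

  C : Carrier → PowerSeries
  C a zero    = a
  C a (suc _) = 0#

  1ₛ : PowerSeries
  1ₛ = C 1#

  X : PowerSeries
  X zero    = 0#
  X (suc n) = 1ₛ n

  cauchyTerms : PowerSeries → PowerSeries → (n : ℕ) → Fin (suc n) → Carrier
  cauchyTerms f g n i = f (toℕ i) * g (n ∸ toℕ i)

  _*ₛ_ : Op₂ PowerSeries
  (f *ₛ g) n = sum (cauchyTerms f g n)

  shift : PowerSeries → PowerSeries
  shift f n = f (suc n)

  _·_ : Carrier → PowerSeries → PowerSeries
  (a · f) n = a * f n

  *ₛ-zero : ∀ f g → (f *ₛ g) 0 ≈ f 0 * g 0
  *ₛ-zero f g = +-identityʳ _

  *ₛ-cong : ∀ {f f′ g g′} → f ≋ f′ → g ≋ g′ → f *ₛ g ≋ f′ *ₛ g′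
  *ₛ-cong {f} {f′} {g} {g′} f≋f′ g≋g′ n = sum-cong-≋ {suc n} {cauchyTerms f g n} {cauchyTerms f′ g′ n}
    (λ i → *-cong (f≋f′ (toℕ i)) (g≋g′ (n ∸ toℕ i)))

  0ₛ-*ₛ : ∀ f → 0ₛ *ₛ f ≋ 0ₛ
  0ₛ-*ₛ f n = trans (sum-cong-≋ {suc n} {cauchyTerms 0ₛ f n} (λ i → zeroˡ (f (n ∸ toℕ i))))
                    (sum-replicate-zero (suc n))

  ·-*ₛ : ∀ a f g → (a · f) *ₛ g ≋ a · (f *ₛ g)
  ·-*ₛ a f g n = begin
    ((a · f) *ₛ g) n                    ≈⟨ sum-cong-≋ {suc n} {cauchyTerms (a · f) g n} (λ i → *-assoc a _ _) ⟩
    sum (λ i → a * cauchyTerms f g n i) ≈⟨ *-distribˡ-sum a (cauchyTerms f g n) ⟨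
    a * (f *ₛ g) n                      ∎

  C-*ₛ : ∀ a f → C a *ₛ f ≋ a · f
  C-*ₛ a f zero    = *ₛ-zero (C a) f
  C-*ₛ a f (suc n) = begin
    a * f (suc n) + (0ₛ *ₛ f) n ≈⟨ +-congˡ (0ₛ-*ₛ f n) ⟩
    a * f (suc n) + 0#          ≈⟨ +-identityʳ _ ⟩
    a * f (suc n)               ∎

  X-*ₛ-zero : ∀ f → (X *ₛ f) 0 ≈ 0#
  X-*ₛ-zero f = trans (*ₛ-zero X f) (zeroˡ (f 0))

  X-*ₛ-suc : ∀ f n → (X *ₛ f) (suc n) ≈ f n
  X-*ₛ-suc f n = begin
    0# * f (suc n) + (1ₛ *ₛ f) n ≈⟨ +-cong (zeroˡ _) (C-*ₛ 1# f n) ⟩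
    0# + 1# * f n                ≈⟨ +-identityˡ _ ⟩
    1# * f n                     ≈⟨ *-identityˡ _ ⟩
    f n                          ∎

  *ₛ-distribʳ : ∀ h f g → (f +ₛ g) *ₛ h ≋ f *ₛ h +ₛ g *ₛ h
  *ₛ-distribʳ h f g n = trans
    (sum-cong-≋ {suc n} {cauchyTerms (f +ₛ g) h n} (λ i → distribʳ (h (n ∸ toℕ i)) _ _))
    (∑-distrib-+ (cauchyTerms f h n) (cauchyTerms g h n))

  *ₛ-comm : ∀ f g → f *ₛ g ≋ g *ₛ f
  *ₛ-comm f g n = begin
    (f *ₛ g) n                                 ≈⟨ ∑-permute (cauchyTerms f g n) reverse ⟩
    sum (λ i → cauchyTerms f g n (opposite i)) ≈⟨ sum-cong-≋ {suc n} reversed ⟩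
    (g *ₛ f) n                                 ∎
    where
    reversed : ∀ i → cauchyTerms f g n (opposite i) ≈ cauchyTerms g f n i
    reversed i rewrite Fin.opposite-prop i | ℕ.m∸[m∸n]≡n (Fin.toℕ≤pred[n] i) =
      *-comm (f (n ∸ toℕ i)) (g (toℕ i))

  -- Induction on the degree, peeling off f 0: by definition of the sum, (f *ₛ g) (1 + n)
  -- is f 0 * g (1 + n) + (shift f *ₛ g) n, i.e. shift (f *ₛ g) is f 0 · shift g +ₛ shift f *ₛ g.
  *ₛ-assoc : ∀ f g h → (f *ₛ g) *ₛ h ≋ f *ₛ (g *ₛ h)
  *ₛ-assoc f g h zero = begin
    (f *ₛ g) 0 * h 0 + 0# ≈⟨ +-identityʳ _ ⟩
    (f *ₛ g) 0 * h 0      ≈⟨ *-congʳ (*ₛ-zero f g) ⟩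
    f 0 * g 0 * h 0       ≈⟨ *-assoc _ _ _ ⟩
    f 0 * (g 0 * h 0)     ≈⟨ *-congˡ (*ₛ-zero g h) ⟨
    f 0 * (g *ₛ h) 0      ≈⟨ *ₛ-zero f (g *ₛ h) ⟨
    (f *ₛ (g *ₛ h)) 0     ∎
  *ₛ-assoc f g h (suc n) = begin
    (f *ₛ g) 0 * h (suc n) + ((f 0 · shift g +ₛ shift f *ₛ g) *ₛ h) n
      ≈⟨ +-cong (*-congʳ (*ₛ-zero f g)) (*ₛ-distribʳ h (f 0 · shift g) (shift f *ₛ g) n) ⟩
    f 0 * g 0 * h (suc n) + ((f 0 · shift g *ₛ h) n + (shift f *ₛ g *ₛ h) n)
      ≈⟨ +-congˡ (+-cong (·-*ₛ (f 0) (shift g) h n) (*ₛ-assoc (shift f) g h n)) ⟩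
    f 0 * g 0 * h (suc n) + (f 0 * (shift g *ₛ h) n + (shift f *ₛ (g *ₛ h)) n)
      ≈⟨ +-assoc _ _ _ ⟨
    f 0 * g 0 * h (suc n) + f 0 * (shift g *ₛ h) n + (shift f *ₛ (g *ₛ h)) n
      ≈⟨ +-congʳ (trans (+-congʳ (*-assoc (f 0) (g 0) (h (suc n)))) (sym (distribˡ (f 0) _ _))) ⟩
    f 0 * (g *ₛ h) (suc n) + (shift f *ₛ (g *ₛ h)) n
      ∎

  *ₛ-identityˡ : ∀ f → 1ₛ *ₛ f ≋ f
  *ₛ-identityˡ f n = trans (C-*ₛ 1# f n) (*-identityˡ (f n))

  powerSeriesRing : CommutativeRing c ℓ
  powerSeriesRing = record
    { Carrier           = PowerSeries
    ; _≈_               = _≋_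
    ; _+_               = _+ₛ_
    ; _*_               = _*ₛ_
    ; -_                = -ₛ_
    ; 0#                = 0ₛ
    ; 1#                = 1ₛ
    ; isCommutativeRing = record
      { isRing = record
        { +-isAbelianGroup = Pointwise.isAbelianGroup +-isAbelianGroup
        ; *-cong           = *ₛ-cong
        ; *-assoc          = *ₛ-assoc
        ; *-identity       = *ₛ-identityˡ , λ f n → trans (*ₛ-comm f 1ₛ n) (*ₛ-identityˡ f n)
        ; distrib          = (λ h f g n → trans (*ₛ-comm h (f +ₛ g) n)
                                (trans (*ₛ-distribʳ h f g n) (+-cong (*ₛ-comm f h n) (*ₛ-comm g h n))))
                           , *ₛ-distribʳ
        }
      ; *-comm = *ₛ-comm
      }
    }

  C-cong : ∀ {a b} → a ≈ b → C a ≋ C b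
  C-cong a≈b zero    = a≈b
  C-cong a≈b (suc n) = refl

  C-+ : ∀ a b → C (a + b) ≋ C a +ₛ C b
  C-+ a b zero    = refl
  C-+ a b (suc n) = sym (+-identityʳ 0#)

  C-* : ∀ a b → C (a * b) ≋ C a *ₛ C b
  C-* a b n = trans (C-*-coeff n) (sym (C-*ₛ a (C b) n))
    where
    C-*-coeff : ∀ n → C (a * b) n ≈ a * C b n
    C-*-coeff zero    = refl
    C-*-coeff (suc n) = sym (zeroʳ a)

  C-neg : ∀ a → C (- a) ≋ -ₛ C a
  C-neg a zero    = refl
  C-neg a (suc n) = sym -0#≈0#

  C-0 : C 0# ≋ 0ₛ
  C-0 zero    = refl
  C-0 (suc n) = refl

  liftMorphism : ∀ {r₁ r₂} {Coeff : RawRing r₁ r₂} →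
                 Coeff -Raw-AlmostCommutative⟶ fromCommutativeRing R →
                 Coeff -Raw-AlmostCommutative⟶ fromCommutativeRing powerSeriesRing
  liftMorphism φ = record
    { ⟦_⟧    = λ a → C ⟦ a ⟧
    ; +-homo = λ a b n → trans (C-cong (+-homo a b) n) (C-+ ⟦ a ⟧ ⟦ b ⟧ n)
    ; *-homo = λ a b n → trans (C-cong (*-homo a b) n) (C-* ⟦ a ⟧ ⟦ b ⟧ n)
    ; -‿homo = λ a n → trans (C-cong (-‿homo a) n) (C-neg ⟦ a ⟧ n)
    ; 0-homo = λ n → trans (C-cong 0-homo n) (C-0 n)
    ; 1-homo = C-cong 1-homo
    }
    where open _-Raw-AlmostCommutative⟶_ φ

  module ∑ₛ = Algebra.Properties.Semiring.Sum (CommutativeRing.semiring powerSeriesRing)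

  ∑ₛ-coeff : ∀ {m} (F : Fin m → PowerSeries) n → ∑ₛ.sum F n ≈ sum (λ i → F i n)
  ∑ₛ-coeff {zero}  F n = refl
  ∑ₛ-coeff {suc m} F n = +-congˡ (∑ₛ-coeff (F ∘′ Fin.suc) n)

open import Algebra.Properties.Semiring.Sum ℤ.+-*-semiring
  using (sum; sum-cong-≗; ∑-distrib-+; sum-replicate-zero)

sumℤ-applyUpTo : ∀ n (h : ℕ → ℤ) (g : ℕ → ℕ) → sumℤ (map h (applyUpTo g n)) ≡ sum {n} (h ∘ g ∘ toℕ)
sumℤ-applyUpTo zero    h g = ≡.refl
sumℤ-applyUpTo (suc n) h g = ≡.cong (ℤ._+_ (h (g 0))) (sumℤ-applyUpTo n h (g ∘ suc))

sumℤ-++ : ∀ xs ys → sumℤ (xs ++ ys) ≡ sumℤ xs ℤ.+ sumℤ ys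
sumℤ-++ []       ys = ≡.sym (ℤ.+-identityˡ (sumℤ ys))
sumℤ-++ (x ∷ xs) ys = ≡.trans (≡.cong (ℤ._+_ x) (sumℤ-++ xs ys)) (≡.sym (ℤ.+-assoc x _ _))

sumℤ-map-concatMap : ∀ {A B : Set} (g : B → ℤ) (f : A → List B) xs →
                     sumℤ (map g (concatMap f xs)) ≡ sumℤ (map (λ x → sumℤ (map g (f x))) xs)
sumℤ-map-concatMap g f []       = ≡.refl
sumℤ-map-concatMap g f (x ∷ xs) = begin
  sumℤ (map g (f x ++ concatMap f xs))                 ≡⟨ ≡.cong sumℤ (List.map-++ g (f x) _) ⟩
  sumℤ (map g (f x) ++ map g (concatMap f xs))         ≡⟨ sumℤ-++ (map g (f x)) _ ⟩
  sumℤ (map g (f x)) ℤ.+ sumℤ (map g (concatMap f xs)) ≡⟨ ≡.cong (ℤ._+_ (sumℤ (map g (f x))))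
                                                                 (sumℤ-map-concatMap g f xs) ⟩
  sumℤ (map (λ x → sumℤ (map g (f x))) (x ∷ xs))       ∎
  where open ≡.≡-Reasoning

sumℤ-map-tabulate : ∀ {A : Set} n (g : A → ℤ) (f : Fin n → A) → sumℤ (map g (tabulate f)) ≡ sum (g ∘ f)
sumℤ-map-tabulate zero    g f = ≡.refl
sumℤ-map-tabulate (suc n) g f = ≡.cong (ℤ._+_ (g (f Fin.zero))) (sumℤ-map-tabulate n g (f ∘ Fin.suc))

indicator : Bool → ℤ
indicator b = if b then + 1 else + 0

length-filter-indicator : ∀ {A : Set} {P : Pred A 0ℓ} (P? : Decidable P) xs →
                          + length (filter P? xs) ≡ sumℤ (map (indicator ∘ does ∘ P?) xs)
length-filter-indicator P? []       = ≡.refl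
length-filter-indicator P? (x ∷ xs) with does (P? x)
... | true  = ≡.cong (ℤ._+_ (+ 1)) (length-filter-indicator P? xs)
... | false = ≡.trans (length-filter-indicator P? xs) (≡.sym (ℤ.+-identityˡ _))

∑-const : ∀ n x → sum {n} (λ _ → x) ≡ + n ℤ.* x
∑-const zero    x = ≡.sym (ℤ.*-zeroˡ x)
∑-const (suc n) x = ≡.trans (≡.cong (ℤ._+_ x) (∑-const n x)) (≡.sym (ℤ.suc-* (+ n) x))

module ℤ⟦z⟧ = PowerSeries ℤ.+-*-commutativeRing
module ℤ⟦z⟧⟦w⟧ = PowerSeries ℤ⟦z⟧.powerSeriesRing

-- A Series maps m to the coefficient of w^m, itself a series in z, so Series is
-- definitionally the carrier of 𝕊 and ⊕, ⊖, ⊝ are its ring operations; ⊛ and the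
-- constants of Defs agree with those of 𝕊 only up to ≈.
𝕊 : CommutativeRing 0ℓ 0ℓ
𝕊 = ℤ⟦z⟧⟦w⟧.powerSeriesRing

open CommutativeRing 𝕊
open import Algebra.Properties.Semiring.Exp semiring using (_^_; ^-homo-*; ^-congʳ)

w z Q : Carrier
w = ℤ⟦z⟧⟦w⟧.X
z = ℤ⟦z⟧⟦w⟧.C ℤ⟦z⟧.X
Q = 1# - z

⟦_⟧ : ℤ → Carrier
⟦ c ⟧ = ℤ⟦z⟧⟦w⟧.C (ℤ⟦z⟧.C c)

1#-coeff-suc : ∀ m n → 1# m (suc n) ≡ + 0
1#-coeff-suc zero    n = ≡.refl
1#-coeff-suc (suc m) n = ≡.refl

w*-coeff-zero : ∀ F n → (w * F) 0 n ≡ + 0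
w*-coeff-zero F = ℤ⟦z⟧⟦w⟧.X-*ₛ-zero F

w*-coeff-suc : ∀ F m n → (w * F) (suc m) n ≡ F m n
w*-coeff-suc F m = ℤ⟦z⟧⟦w⟧.X-*ₛ-suc F m

z*-coeff-zero : ∀ F m → (z * F) m 0 ≡ + 0
z*-coeff-zero F m = ≡.trans (ℤ⟦z⟧⟦w⟧.C-*ₛ ℤ⟦z⟧.X F m 0) (ℤ⟦z⟧.X-*ₛ-zero (F m))

z*-coeff-suc : ∀ F m n → (z * F) m (suc n) ≡ F m n
z*-coeff-suc F m n = ≡.trans (ℤ⟦z⟧⟦w⟧.C-*ₛ ℤ⟦z⟧.X F m (suc n)) (ℤ⟦z⟧.X-*ₛ-suc (F m) n)

⟦⟧*-coeff : ∀ c F m n → (⟦ c ⟧ * F) m n ≡ c ℤ.* F m n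
⟦⟧*-coeff c F m n = ≡.trans (ℤ⟦z⟧⟦w⟧.C-*ₛ (ℤ⟦z⟧.C c) F m n) (ℤ⟦z⟧.C-*ₛ c (F m) n)

⊛≈* : ∀ f g → f ⊛ g ≈ f * g
⊛≈* f g m n = begin
  (f ⊛ g) m n
    ≡⟨ sumℤ-applyUpTo (suc m) (λ i → sumℤ (map (term i) (upTo (suc n)))) id ⟩
  sum {suc m} (λ i → sumℤ (map (term (toℕ i)) (upTo (suc n))))
    ≡⟨ sum-cong-≗ {suc m} (λ i → sumℤ-applyUpTo (suc n) (term (toℕ i)) id) ⟩
  sum {suc m} (λ i → (f (toℕ i) ℤ⟦z⟧.*ₛ g (m ∸ toℕ i)) n)
    ≡⟨ ℤ⟦z⟧.∑ₛ-coeff (ℤ⟦z⟧⟦w⟧.cauchyTerms f g m) n ⟨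
  (f * g) m n ∎
  where
  open ≡.≡-Reasoning
  term : ℕ → ℕ → ℤ
  term i j = f i j ℤ.* g (m ∸ i) (n ∸ j)

⊛-≈ : ∀ {f f′ g g′} → f ≈ f′ → g ≈ g′ → f ⊛ g ≈ f′ * g′
⊛-≈ {f} {g = g} f≈f′ g≈g′ = trans (⊛≈* f g) (*-cong f≈f′ g≈g′)

⊝-≈ : ∀ {f f′ g g′} → f ≈ f′ → g ≈ g′ → f ⊝ g ≈ f′ - g′
⊝-≈ f≈f′ g≈g′ = +-cong f≈f′ (-‿cong g≈g′)

const≈⟦⟧ : ∀ c → const c ≈ ⟦ c ⟧
const≈⟦⟧ c zero    zero    = ≡.refl
const≈⟦⟧ c zero    (suc n) = ≡.refl
const≈⟦⟧ c (suc m) n       = ≡.refl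

oneS≈1# : oneS ≈ 1#
oneS≈1# = const≈⟦⟧ (+ 1)

zS≈z : zS ≈ z
zS≈z zero    zero          = ≡.refl
zS≈z zero    (suc zero)    = ≡.refl
zS≈z zero    (suc (suc n)) = ≡.refl
zS≈z (suc m) n             = ≡.refl

wS≈w : wS ≈ w
wS≈w zero          n       = ≡.refl
wS≈w (suc zero)    zero    = ≡.refl
wS≈w (suc zero)    (suc n) = ≡.refl
wS≈w (suc (suc m)) n       = ≡.refl

^S≈^ : ∀ {f g} → f ≈ g → ∀ e → f ^S e ≈ g ^ e
^S≈^ f≈g zero    = oneS≈1#
^S≈^ f≈g (suc e) = ⊛-≈ f≈g (^S≈^ f≈g e)

ℤ⟶𝕊 : _ -Raw-AlmostCommutative⟶ fromCommutativeRing 𝕊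
ℤ⟶𝕊 = ℤ⟦z⟧⟦w⟧.liftMorphism (ℤ⟦z⟧.liftMorphism
          (-raw-almostCommutative⟶ (fromCommutativeRing ℤ.+-*-commutativeRing)))

coefficient? : ∀ a b → Maybe (⟦ a ⟧ ≈ ⟦ b ⟧)
coefficient? a b with a ℤ.≟ b
... | yes ≡.refl = just refl
... | no _       = nothing

open import Algebra.Solver.Ring _ (fromCommutativeRing 𝕊) ℤ⟶𝕊 coefficient?
  using (solve; _:=_; con; _:+_; _:*_; _:-_)

module Words (ℓ : ℕ) where

  Word : Set
  Word = List (Fin ℓ)

  ∑-words : ℕ → (Word → ℤ) → ℤ
  ∑-words zero    g = g []
  ∑-words (suc n) g = sum {ℓ} (λ a → ∑-words n (λ v → g (a ∷ v)))

  ∑-words-cong : ∀ n {g h : Word → ℤ} → (∀ v → g v ≡ h v) → ∑-words n g ≡ ∑-words n h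
  ∑-words-cong zero    g≗h = g≗h []
  ∑-words-cong (suc n) g≗h = sum-cong-≗ {ℓ} (λ a → ∑-words-cong n (λ v → g≗h (a ∷ v)))

  ∑-words-+ : ∀ n (g h : Word → ℤ) → ∑-words n (λ v → g v ℤ.+ h v) ≡ ∑-words n g ℤ.+ ∑-words n h
  ∑-words-+ zero    g h = ≡.refl
  ∑-words-+ (suc n) g h = ≡.trans
    (sum-cong-≗ {ℓ} (λ a → ∑-words-+ n (λ v → g (a ∷ v)) (λ v → h (a ∷ v))))
    (∑-distrib-+ (λ a → ∑-words n (λ v → g (a ∷ v))) (λ a → ∑-words n (λ v → h (a ∷ v))))

  ∑-words-zero : ∀ n → ∑-words n (λ _ → + 0) ≡ + 0
  ∑-words-zero zero    = ≡.refl
  ∑-words-zero (suc n) = ≡.trans (sum-cong-≗ {ℓ} (λ _ → ∑-words-zero n)) (sum-replicate-zero ℓ)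

  sumℤ-words : ∀ n (g : Word → ℤ) → sumℤ (map g (words ℓ n)) ≡ ∑-words n g
  sumℤ-words zero    g = ℤ.+-identityʳ (g [])
  sumℤ-words (suc n) g = begin
    sumℤ (map g (concatMap (λ a → map (a ∷_) (words ℓ n)) (allFin ℓ)))
      ≡⟨ sumℤ-map-concatMap g _ (allFin ℓ) ⟩
    sumℤ (map (λ a → sumℤ (map g (map (a ∷_) (words ℓ n)))) (allFin ℓ))
      ≡⟨ sumℤ-map-tabulate ℓ _ id ⟩
    sum {ℓ} (λ a → sumℤ (map g (map (a ∷_) (words ℓ n))))
      ≡⟨ sum-cong-≗ {ℓ} (λ a → ≡.trans (≡.cong sumℤ (≡.sym (List.map-∘ (words ℓ n))))
                                         (sumℤ-words n _)) ⟩
    ∑-words (suc n) g ∎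
    where open ≡.≡-Reasoning

module Runs {ℓ : ℕ} where

  runs-∷ : ∀ (a : Fin ℓ) v → ∃₂ λ c rs → runs (a ∷ v) ≡ (a , suc c) ∷ rs
  runs-∷ a v with runs v
  ... | [] = 0 , [] , ≡.refl
  ... | (b , c) ∷ rs with a Fin.≟ b
  ...   | yes ≡.refl = c , rs , ≡.refl
  ...   | no _       = 0 , (b , c) ∷ rs , ≡.refl

  pushRun-same : ∀ (a : Fin ℓ) c rs → pushRun a ((a , c) ∷ rs) ≡ (a , suc c) ∷ rs
  pushRun-same a c rs rewrite dec-true (a Fin.≟ a) ≡.refl = ≡.refl

  pushRun-other : ∀ {a b : Fin ℓ} c rs → a ≢ b → pushRun a ((b , c) ∷ rs) ≡ (a , 1) ∷ (b , c) ∷ rs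
  pushRun-other {a} {b} c rs a≢b rewrite dec-false (a Fin.≟ b) a≢b = ≡.refl

  prefixMatch-mismatch : ∀ {a b : Fin ℓ} t q v → a ≢ b → prefixMatch ((b , t) ∷ q) (runs (a ∷ v)) ≡ false
  prefixMatch-mismatch {a} {b} t q v a≢b with runs-∷ a v
  ... | c , rs , eq rewrite eq | dec-false (b Fin.≟ a) (a≢b ∘ ≡.sym) = ≡.refl

  prefixMatch-pushRun : ∀ (a : Fin ℓ) t q rs →
                        prefixMatch ((a , suc (suc t)) ∷ q) (pushRun a rs) ≡ prefixMatch ((a , suc t) ∷ q) rs
  prefixMatch-pushRun a t q [] rewrite dec-true (a Fin.≟ a) ≡.refl = ≡.refl
  prefixMatch-pushRun a t q ((b , c) ∷ rs) with a Fin.≟ b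
  ... | yes ≡.refl rewrite dec-true (a Fin.≟ a) ≡.refl = ≡.refl
  ... | no _       rewrite dec-true (a Fin.≟ a) ≡.refl = ≡.refl

-- Counting patterns

module Patterns (L : ℕ) (k : Fin (suc (suc L)) → ℕ) (k-pos : ∀ i → 1 ≤ k i) where

  ℓ : ℕ
  ℓ = suc (suc L)

  open Words ℓ
  open Runs

  pat : Word → ℕ
  pat = patterns k

  tailPattern : List (Fin ℓ × ℕ)
  tailPattern = map (λ i → (i , k i)) (tabulate {n = suc L} Fin.suc)

  pat-suc∷ : ∀ b v → pat (Fin.suc b ∷ v) ≡ pat v
  pat-suc∷ b v with runs v
  ... | [] = ≡.refl
  ... | (c , t) ∷ rs with Fin.suc b Fin.≟ c
  ...   | yes ≡.refl = ≡.refl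
  ...   | no _       = ≡.refl

  j₀ : ℕ
  j₀ = ℕ.pred (k Fin.zero)

  k₁≡1+j₀ : k Fin.zero ≡ suc j₀
  k₁≡1+j₀ with k Fin.zero | k-pos Fin.zero
  ... | suc _ | _ = ≡.refl

  -- For
  -- j = j₀ = k₁ − 1, onesThenTail j₀ (runs v) says that 1·v has one pattern more than v.
  onesThenTail : ℕ → List (Fin ℓ × ℕ) → Bool
  onesThenTail zero    rs             = prefixMatch tailPattern rs
  onesThenTail (suc j) []             = false
  onesThenTail (suc j) ((b , c) ∷ rs) = does (Fin.zero Fin.≟ b) ∧ (c ≡ᵇ suc j) ∧ prefixMatch tailPattern rs

  <ᵇ-suc-split : ∀ j c x → (if (j <ᵇ suc c) ∧ x then 1 else 0)
                           ≡ (if (c ≡ᵇ j) ∧ x then 1 else 0) ℕ.+ (if (j <ᵇ c) ∧ x then 1 else 0)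
  <ᵇ-suc-split zero    zero    true  = ≡.refl
  <ᵇ-suc-split zero    zero    false = ≡.refl
  <ᵇ-suc-split zero    (suc c) true  = ≡.refl
  <ᵇ-suc-split zero    (suc c) false = ≡.refl
  <ᵇ-suc-split (suc j) zero    true  = ≡.refl
  <ᵇ-suc-split (suc j) zero    false = ≡.refl
  <ᵇ-suc-split (suc j) (suc c) x     = <ᵇ-suc-split j c x

  countOcc-zero∷ : ∀ j v → countOcc ((Fin.zero , suc j) ∷ tailPattern) (runs (Fin.zero ∷ v))
                           ≡ (if onesThenTail j (runs v) then 1 else 0)
                             ℕ.+ countOcc ((Fin.zero , suc j) ∷ tailPattern) (runs v)
  countOcc-zero∷ zero    []      = ≡.refl
  countOcc-zero∷ (suc j) []      = ≡.refl
  countOcc-zero∷ j       (a ∷ v) with runs-∷ a v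
  ... | c , rs , eq rewrite eq = by-first-run j a
    where
    P : ℕ → List (Fin ℓ × ℕ)
    P j = (Fin.zero , suc j) ∷ tailPattern
    by-first-run : ∀ j a → countOcc (P j) (pushRun Fin.zero ((a , suc c) ∷ rs))
                           ≡ (if onesThenTail j ((a , suc c) ∷ rs) then 1 else 0)
                             ℕ.+ countOcc (P j) ((a , suc c) ∷ rs)
    by-first-run zero    Fin.zero    = ≡.refl
    by-first-run (suc j) Fin.zero    = ≡.trans
      (≡.cong (ℕ._+ countOcc (P (suc j)) rs) (<ᵇ-suc-split j c _))
      (ℕ.+-assoc (if (c ≡ᵇ j) ∧ prefixMatch tailPattern rs then 1 else 0) _ _)
    by-first-run zero    (Fin.suc a) = ≡.refl
    by-first-run (suc j) (Fin.suc a) = ≡.refl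

  pat-zero∷ : ∀ v → pat (Fin.zero ∷ v) ≡ (if onesThenTail j₀ (runs v) then 1 else 0) ℕ.+ pat v
  pat-zero∷ v = ≡.subst (λ k₁ → countOcc ((Fin.zero , k₁) ∷ tailPattern) (runs (Fin.zero ∷ v))
                                 ≡ (if onesThenTail j₀ (runs v) then 1 else 0)
                                   ℕ.+ countOcc ((Fin.zero , k₁) ∷ tailPattern) (runs v))
                        (≡.sym k₁≡1+j₀) (countOcc-zero∷ j₀ v)

  onesThenTail-unique : ∀ i j rs → onesThenTail i rs ≡ true → onesThenTail j rs ≡ true → i ≡ j
  onesThenTail-unique zero    zero    rs                     _ _ = ≡.refl
  onesThenTail-unique zero    (suc j) ((Fin.zero , c) ∷ rs)  () _
  onesThenTail-unique zero    (suc j) ((Fin.suc b , c) ∷ rs) _ ()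
  onesThenTail-unique (suc i) zero    ((Fin.zero , c) ∷ rs)  _ ()
  onesThenTail-unique (suc i) zero    ((Fin.suc b , c) ∷ rs) () _
  onesThenTail-unique (suc i) (suc j) ((Fin.zero , c) ∷ rs) eqᵢ eqⱼ =
    ≡.trans (≡.sym (≡ᵇ-∧-sound c (suc i) eqᵢ)) (≡ᵇ-∧-sound c (suc j) eqⱼ)
    where
    ≡ᵇ-∧-sound : ∀ m n {x} → (m ≡ᵇ n) ∧ x ≡ true → m ≡ n
    ≡ᵇ-∧-sound zero    zero    _ = ≡.refl
    ≡ᵇ-∧-sound (suc m) (suc n) e = ≡.cong suc (≡ᵇ-∧-sound m n e)

  onesThenTail-zero∷ : ∀ j v → onesThenTail (suc j) (runs (Fin.zero ∷ v)) ≡ onesThenTail j (runs v)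
  onesThenTail-zero∷ zero    []      = ≡.refl
  onesThenTail-zero∷ (suc j) []      = ≡.refl
  onesThenTail-zero∷ j       (a ∷ v) with runs-∷ a v
  ... | c , rs , eq rewrite eq = by-first-run j a
    where
    by-first-run : ∀ j a → onesThenTail (suc j) (pushRun Fin.zero ((a , suc c) ∷ rs))
                           ≡ onesThenTail j ((a , suc c) ∷ rs)
    by-first-run zero    Fin.zero    = ≡.refl
    by-first-run (suc j) Fin.zero    = ≡.refl
    by-first-run zero    (Fin.suc a) = ≡.refl
    by-first-run (suc j) (Fin.suc a) = ≡.refl

  onesThenTail-suc∷ : ∀ j b v → onesThenTail (suc j) (runs (Fin.suc b ∷ v)) ≡ false
  onesThenTail-suc∷ j b v with runs-∷ (Fin.suc b) v
  ... | c , rs , eq rewrite eq = ≡.refl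

  -- Generating functions of sets of words

  δ : ℕ → ℕ → ℤ
  δ p m = indicator (does (p ℕ.≟ m))

  gf : (Word → Bool) → Carrier
  gf P m n = ∑-words n (λ v → if P v then δ (pat v) m else + 0)

  G : Carrier
  G = gf (λ _ → true)

  Gtilde≈G : Gtilde ℓ k ≈ G
  Gtilde≈G m n = ≡.trans (length-filter-indicator (λ v → pat v ℕ.≟ m) (words ℓ n)) (sumℤ-words n _)

  gf-cong : ∀ {P Q} → (∀ v → P v ≡ Q v) → gf P ≈ gf Q
  gf-cong P≗Q m n = ∑-words-cong n (λ v → ≡.cong (λ b → if b then δ (pat v) m else + 0) (P≗Q v))

  gf-∨ : ∀ {P Q R} → (∀ v → P v ≡ Q v ∨ R v) → (∀ v → Q v ∧ R v ≡ false) → gf P ≈ gf Q + gf R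
  gf-∨ {P} {Q} {R} P≗Q∨R disjoint m n = ≡.trans (∑-words-cong n split) (∑-words-+ n _ _)
    where
    split : ∀ v → (if P v then δ (pat v) m else + 0)
                  ≡ (if Q v then δ (pat v) m else + 0) ℤ.+ (if R v then δ (pat v) m else + 0)
    split v rewrite P≗Q∨R v with Q v | R v | disjoint v
    ... | true  | false | _ = ≡.sym (ℤ.+-identityʳ _)
    ... | false | true  | _ = ≡.sym (ℤ.+-identityˡ _)
    ... | false | false | _ = ≡.refl

  gf-∷ : ∀ a P → P [] ≡ false → (∀ b v → b ≢ a → P (b ∷ v) ≡ false) →
         (∀ v → P (a ∷ v) ≡ true → pat (a ∷ v) ≡ pat v) → gf P ≈ z * gf (λ v → P (a ∷ v))
  gf-∷ a P P[]≡false others same-count m zero =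
    ≡.trans (≡.cong (λ b → if b then δ 0 m else + 0) P[]≡false)
            (≡.sym (z*-coeff-zero (gf (λ v → P (a ∷ v))) m))
  gf-∷ a P P[]≡false others same-count m (suc n) = begin
    sum {ℓ} (λ b → ∑-words n (λ v → if P (b ∷ v) then δ (pat (b ∷ v)) m else + 0))
      ≡⟨ sum-supportedAt ℤ.+-0-commutativeMonoid _ a vanishes ⟩
    ∑-words n (λ v → if P (a ∷ v) then δ (pat (a ∷ v)) m else + 0)
      ≡⟨ ∑-words-cong n drop-a ⟩
    gf (λ v → P (a ∷ v)) m n
      ≡⟨ z*-coeff-suc (gf (λ v → P (a ∷ v))) m n ⟨
    (z * gf (λ v → P (a ∷ v))) m (suc n) ∎
    where
    open ≡.≡-Reasoning
    vanishes : ∀ b → b ≢ a → ∑-words n (λ v → if P (b ∷ v) then δ (pat (b ∷ v)) m else + 0) ≡ + 0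
    vanishes b b≢a = ≡.trans
      (∑-words-cong n (λ v → ≡.cong (λ x → if x then δ (pat (b ∷ v)) m else + 0) (others b v b≢a)))
      (∑-words-zero n)
    drop-a : ∀ v → (if P (a ∷ v) then δ (pat (a ∷ v)) m else + 0) ≡ (if P (a ∷ v) then δ (pat v) m else + 0)
    drop-a v with P (a ∷ v) in eq
    ... | true  = ≡.cong (λ p → δ p m) (same-count v eq)
    ... | false = ≡.refl

  gf-count+1 : ∀ P m n → ∑-words n (λ v → if P v then δ (suc (pat v)) m else + 0) ≡ (w * gf P) m n
  gf-count+1 P zero    n =
    ≡.trans (∑-words-cong n (λ v → zero-if (P v))) (≡.trans (∑-words-zero n) (≡.sym (w*-coeff-zero (gf P) n)))
    where
    zero-if : ∀ b → (if b then + 0 else + 0) ≡ + 0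
    zero-if true  = ≡.refl
    zero-if false = ≡.refl
  gf-count+1 P (suc m) n = ≡.sym (w*-coeff-suc (gf P) m n)

  D : ℕ → Carrier
  D j = gf (λ v → onesThenTail j (runs v))

  words-starting-with-1 : ∀ m n → ∑-words n (λ v → δ (pat (Fin.zero ∷ v)) m) ℤ.+ D j₀ m n
                                  ≡ G m n ℤ.+ (w * D j₀) m n
  words-starting-with-1 m n = begin
    ∑-words n (λ v → δ (pat (Fin.zero ∷ v)) m) ℤ.+ D j₀ m n
      ≡⟨ ∑-words-+ n _ _ ⟨
    ∑-words n (λ v → δ (pat (Fin.zero ∷ v)) m ℤ.+ (if E v then δ (pat v) m else + 0))
      ≡⟨ ∑-words-cong n shift-count ⟩
    ∑-words n (λ v → δ (pat v) m ℤ.+ (if E v then δ (suc (pat v)) m else + 0))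
      ≡⟨ ∑-words-+ n _ _ ⟩
    G m n ℤ.+ ∑-words n (λ v → if E v then δ (suc (pat v)) m else + 0)
      ≡⟨ ≡.cong (ℤ._+_ (G m n)) (gf-count+1 E m n) ⟩
    G m n ℤ.+ (w * D j₀) m n ∎
    where
    open ≡.≡-Reasoning
    E : Word → Bool
    E v = onesThenTail j₀ (runs v)
    shift-count : ∀ v → δ (pat (Fin.zero ∷ v)) m ℤ.+ (if E v then δ (pat v) m else + 0)
                        ≡ δ (pat v) m ℤ.+ (if E v then δ (suc (pat v)) m else + 0)
    shift-count v rewrite pat-zero∷ v with E v
    ... | true  = ℤ.+-comm (δ (suc (pat v)) m) (δ (pat v) m)
    ... | false = ≡.refl

  G-rec : G + z * D j₀ ≈ 1# + z * (⟦ + ℓ ⟧ * G + w * D j₀)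
  G-rec m zero = ≡.cong₂ ℤ._+_ (empty-word m)
    (≡.trans (z*-coeff-zero (D j₀) m) (≡.sym (z*-coeff-zero (⟦ + ℓ ⟧ * G + w * D j₀) m)))
    where
    empty-word : ∀ m → G m 0 ≡ 1# m 0
    empty-word zero    = ≡.refl
    empty-word (suc m) = ≡.refl
  G-rec m (suc n) = begin
    (first ℤ.+ sum {suc L} (λ b → ∑-words n (λ v → δ (pat (Fin.suc b ∷ v)) m))) ℤ.+ (z * D j₀) m (suc n)
      ≡⟨ ≡.cong₂ (λ x y → (first ℤ.+ x) ℤ.+ y) later-letters (z*-coeff-suc (D j₀) m n) ⟩
    (first ℤ.+ + suc L ℤ.* G m n) ℤ.+ D j₀ m n
      ≡⟨ shuffle first _ _ ⟩
    (first ℤ.+ D j₀ m n) ℤ.+ + suc L ℤ.* G m n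
      ≡⟨ ≡.cong (ℤ._+ (+ suc L ℤ.* G m n)) (words-starting-with-1 m n) ⟩
    (G m n ℤ.+ (w * D j₀) m n) ℤ.+ + suc L ℤ.* G m n
      ≡⟨ collect (G m n) _ _ ⟩
    + 0 ℤ.+ ((G m n ℤ.+ + suc L ℤ.* G m n) ℤ.+ (w * D j₀) m n)
      ≡⟨ ≡.cong (λ x → + 0 ℤ.+ (x ℤ.+ (w * D j₀) m n))
                (≡.trans (⟦⟧*-coeff (+ ℓ) G m n) (ℤ.suc-* (+ suc L) (G m n))) ⟨
    + 0 ℤ.+ ((⟦ + ℓ ⟧ * G) m n ℤ.+ (w * D j₀) m n)
      ≡⟨ ≡.cong₂ ℤ._+_ (1#-coeff-suc m n) (z*-coeff-suc (⟦ + ℓ ⟧ * G + w * D j₀) m n) ⟨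
    (1# + z * (⟦ + ℓ ⟧ * G + w * D j₀)) m (suc n) ∎
    where
    open ≡.≡-Reasoning
    first : ℤ
    first = ∑-words n (λ v → δ (pat (Fin.zero ∷ v)) m)
    later-letters : sum {suc L} (λ b → ∑-words n (λ v → δ (pat (Fin.suc b ∷ v)) m)) ≡ + suc L ℤ.* G m n
    later-letters = ≡.trans
      (sum-cong-≗ {suc L} λ b → ∑-words-cong n (λ v → ≡.cong (λ p → δ p m) (pat-suc∷ b v)))
      (∑-const (suc L) (G m n))
    shuffle : ∀ a s d → (a ℤ.+ s) ℤ.+ d ≡ (a ℤ.+ d) ℤ.+ s
    shuffle = solve-∀
    collect : ∀ t u s → (t ℤ.+ u) ℤ.+ s ≡ + 0 ℤ.+ ((t ℤ.+ s) ℤ.+ u)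
    collect = solve-∀

  D-suc : ∀ {j} → j < j₀ → D (suc j) ≈ z * D j
  D-suc {j} j<j₀ = trans (gf-∷ Fin.zero (λ v → onesThenTail (suc j) (runs v)) ≡.refl others same-count)
                         (*-congˡ {z} (gf-cong (onesThenTail-zero∷ j)))
    where
    others : ∀ b v → b ≢ Fin.zero → onesThenTail (suc j) (runs (b ∷ v)) ≡ false
    others Fin.zero    v 0≢0 = contradiction ≡.refl 0≢0
    others (Fin.suc b) v _   = onesThenTail-suc∷ j b v
    same-count : ∀ v → onesThenTail (suc j) (runs (Fin.zero ∷ v)) ≡ true → pat (Fin.zero ∷ v) ≡ pat v
    same-count v e = ≡.trans (pat-zero∷ v) (≡.cong (λ b → (if b then 1 else 0) ℕ.+ pat v) (Bool.¬-not not-j₀))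
      where
      not-j₀ : onesThenTail j₀ (runs v) ≢ true
      not-j₀ e₀ = ℕ.<⇒≢ j<j₀
        (onesThenTail-unique j j₀ (runs v) (≡.trans (≡.sym (onesThenTail-zero∷ j v)) e) e₀)

  D-chain : ∀ {j} → j ≤ j₀ → D j ≈ z ^ j * D 0
  D-chain {zero}  _    = sym (*-identityˡ (D 0))
  D-chain {suc j} j<j₀ =
    trans (D-suc j<j₀) (trans (*-congˡ {z} (D-chain (ℕ.<⇒≤ j<j₀))) (sym (*-assoc z (z ^ j) (D 0))))

  Z : List (Fin ℓ × ℕ) → Carrier
  Z q = gf (λ v → prefixMatch q (runs v))

  Z-∷ : ∀ b t q → Z ((Fin.suc b , t) ∷ q)
                  ≈ z * gf (λ v → prefixMatch ((Fin.suc b , t) ∷ q) (runs (Fin.suc b ∷ v)))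
  Z-∷ b t q = gf-∷ (Fin.suc b) (λ v → prefixMatch ((Fin.suc b , t) ∷ q) (runs v)) ≡.refl
                   (λ c v c≢b → prefixMatch-mismatch t q v c≢b) (λ v _ → pat-suc∷ b v)

  Z-longer : ∀ b t q → Z ((Fin.suc b , suc (suc t)) ∷ q) ≈ z * Z ((Fin.suc b , suc t) ∷ q)
  Z-longer b t q =
    trans (Z-∷ b (suc (suc t)) q) (*-congˡ {z} (gf-cong (λ v → prefixMatch-pushRun (Fin.suc b) t q (runs v))))

  Z-first-run : ∀ b t q → Z ((Fin.suc b , suc t) ∷ q) ≈ z ^ t * Z ((Fin.suc b , 1) ∷ q)
  Z-first-run b zero    q = sym (*-identityˡ (Z ((Fin.suc b , 1) ∷ q)))
  Z-first-run b (suc t) q =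
    trans (Z-longer b t q) (trans (*-congˡ {z} (Z-first-run b t q)) (sym (*-assoc z (z ^ t) (Z ((Fin.suc b , 1) ∷ q)))))

  Z-single : ∀ b → Z ((Fin.suc b , 1) ∷ []) ≈ z * G
  Z-single b = trans (Z-∷ b 1 []) (*-congˡ {z} (gf-cong matches))
    where
    matches : ∀ v → prefixMatch ((Fin.suc b , 1) ∷ []) (runs (Fin.suc b ∷ v)) ≡ true
    matches v with runs-∷ (Fin.suc b) v
    ... | c , rs , eq rewrite eq | dec-true (Fin.suc b Fin.≟ Fin.suc b) ≡.refl = ≡.refl

  Y : Fin (suc L) → List (Fin ℓ × ℕ) → Carrier
  Y b q = gf (λ v → prefixMatch ((Fin.suc b , 1) ∷ q) (runs (Fin.suc b ∷ v)))

  _◃_ : Fin ℓ → (Word → Bool) → Word → Bool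
  (a ◃ P) []      = false
  (a ◃ P) (b ∷ v) = does (b Fin.≟ a) ∧ P v

  gf-◃ : ∀ b P → gf (Fin.suc b ◃ P) ≈ z * gf P
  gf-◃ b P = trans
    (gf-∷ (Fin.suc b) (Fin.suc b ◃ P) ≡.refl
          (λ c v c≢b → ≡.cong (_∧ P v) (dec-false (c Fin.≟ Fin.suc b) c≢b)) (λ v _ → pat-suc∷ b v))
    (*-congˡ {z} (gf-cong (λ v → ≡.cong (_∧ P v) (dec-true (Fin.suc b Fin.≟ Fin.suc b) ≡.refl))))

  -- After its first letter b, a word counted by Y either matches q at once or continues with another b.
  Y-rec : ∀ b {c u q} → Fin.suc b ≢ c → Y b ((c , u) ∷ q) ≈ Z ((c , u) ∷ q) + z * Y b ((c , u) ∷ q)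
  Y-rec b {c} {u} {q} b≢c =
    trans (gf-∨ {Q = λ v → prefixMatch ((c , u) ∷ q) (runs v)} {R = Fin.suc b ◃ P} split disjoint)
          (+-congˡ {Z ((c , u) ∷ q)} (gf-◃ b P))
    where
    P : Word → Bool
    P v = prefixMatch ((Fin.suc b , 1) ∷ (c , u) ∷ q) (runs (Fin.suc b ∷ v))
    split : ∀ v → P v ≡ prefixMatch ((c , u) ∷ q) (runs v) ∨ (Fin.suc b ◃ P) v
    split [] rewrite dec-true (Fin.suc b Fin.≟ Fin.suc b) ≡.refl = ≡.refl
    split (a ∷ v) with a Fin.≟ Fin.suc b
    ... | yes ≡.refl with runs-∷ (Fin.suc b) v
    ...   | c′ , rs , eq rewrite eq | pushRun-same (Fin.suc b) (suc c′) rs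
                                    | dec-true (Fin.suc b Fin.≟ Fin.suc b) ≡.refl
                                    | dec-false (c Fin.≟ Fin.suc b) (b≢c ∘ ≡.sym) = ≡.refl
    split (a ∷ v) | no a≢b with runs-∷ a v
    ...   | c′ , rs , eq rewrite eq | pushRun-other (suc c′) rs (a≢b ∘ ≡.sym)
                                    | dec-true (Fin.suc b Fin.≟ Fin.suc b) ≡.refl = ≡.sym (Bool.∨-identityʳ _)
    disjoint : ∀ v → prefixMatch ((c , u) ∷ q) (runs v) ∧ (Fin.suc b ◃ P) v ≡ false
    disjoint []      = ≡.refl
    disjoint (a ∷ v) with a Fin.≟ Fin.suc b
    ... | yes ≡.refl rewrite prefixMatch-mismatch u q v b≢c = ≡.refl
    ... | no _       = Bool.∧-zeroʳ _

  Y-geometric : ∀ b {c u q} → Fin.suc b ≢ c → Q * Y b ((c , u) ∷ q) ≈ Z ((c , u) ∷ q)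
  Y-geometric b {c} {u} {q} b≢c = begin
    Q * Yq                 ≈⟨ solve 2 (λ z y → (con (+ 1) :- z) :* y := y :- z :* y) refl z Yq ⟩
    Yq - z * Yq            ≈⟨ +-congʳ (Y-rec b b≢c) ⟩
    (Zq + z * Yq) - z * Yq ≈⟨ solve 2 (λ x y → (x :+ y) :- y := x) refl Zq (z * Yq) ⟩
    Zq                     ∎
    where
    open import Relation.Binary.Reasoning.Setoid setoid
    Yq = Y b ((c , u) ∷ q)
    Zq = Z ((c , u) ∷ q)

  data Chain : List (Fin ℓ × ℕ) → Set where
    single : ∀ b {t} → 1 ≤ t → Chain ((Fin.suc b , t) ∷ [])
    extend : ∀ b {t c u q} → 1 ≤ t → Fin.suc b ≢ c → Chain ((c , u) ∷ q) →
             Chain ((Fin.suc b , t) ∷ (c , u) ∷ q)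

  totalLength : List (Fin ℓ × ℕ) → ℕ
  totalLength q = ℕ.sum (map proj₂ q)

  Z-chain : ∀ {q} → Chain q → Q ^ (length q ∸ 1) * Z q ≈ z ^ totalLength q * G
  Z-chain (single b {suc t} (s≤s z≤n)) = begin
    1# * Z ((Fin.suc b , suc t) ∷ []) ≈⟨ *-identityˡ (Z ((Fin.suc b , suc t) ∷ [])) ⟩
    Z ((Fin.suc b , suc t) ∷ [])      ≈⟨ Z-first-run b t [] ⟩
    z ^ t * Z ((Fin.suc b , 1) ∷ [])  ≈⟨ *-congˡ {z ^ t} (Z-single b) ⟩
    z ^ t * (z * G)                   ≈⟨ solve 3 (λ a z g → a :* (z :* g) := (z :* a) :* g) refl (z ^ t) z G ⟩
    z ^ suc t * G                     ≈⟨ *-congʳ {G} (^-congʳ z (ℕ.+-identityʳ (suc t))) ⟨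
    z ^ (suc t ℕ.+ 0) * G             ∎
    where open import Relation.Binary.Reasoning.Setoid setoid
  Z-chain (extend b {suc t} {c} {u} {q} (s≤s z≤n) b≢c chain) = begin
    Q ^ suc l * Z ((Fin.suc b , suc t) ∷ q′)
      ≈⟨ *-congˡ {Q ^ suc l} (trans (Z-first-run b t q′) (*-congˡ {z ^ t} (Z-∷ b 1 q′))) ⟩
    Q ^ suc l * (z ^ t * (z * Yq))
      ≈⟨ solve 5 (λ q ql a z y → (q :* ql) :* (a :* (z :* y)) := (z :* a) :* (ql :* (q :* y)))
               refl Q (Q ^ l) (z ^ t) z Yq ⟩
    z ^ suc t * (Q ^ l * (Q * Yq))
      ≈⟨ *-congˡ {z ^ suc t} (*-congˡ {Q ^ l} (Y-geometric b b≢c)) ⟩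
    z ^ suc t * (Q ^ l * Z q′)
      ≈⟨ *-congˡ {z ^ suc t} (Z-chain chain) ⟩
    z ^ suc t * (z ^ totalLength q′ * G)
      ≈⟨ *-assoc (z ^ suc t) (z ^ totalLength q′) G ⟨
    z ^ suc t * z ^ totalLength q′ * G
      ≈⟨ *-congʳ {G} (^-homo-* z (suc t) (totalLength q′)) ⟨
    z ^ (suc t ℕ.+ totalLength q′) * G ∎
    where
    open import Relation.Binary.Reasoning.Setoid setoid
    q′ = (c , u) ∷ q
    l = length q
    Yq = Y b q′

  tailPattern-chain : Chain tailPattern
  tailPattern-chain = chain-tabulate L id id
    where
    chain-tabulate : ∀ r (g : Fin (suc r) → Fin (suc L)) → Injective _≡_ _≡_ g →
                     Chain (map (λ i → (i , k i)) (tabulate (Fin.suc ∘ g)))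
    chain-tabulate zero    g _   = single (g Fin.zero) (k-pos _)
    chain-tabulate (suc r) g inj = extend (g Fin.zero) (k-pos _) (Fin.0≢1+n ∘ inj ∘ Fin.suc-injective)
                                          (chain-tabulate r (g ∘ Fin.suc) (Fin.suc-injective ∘ inj))

  length-tailPattern : length tailPattern ∸ 1 ≡ L
  length-tailPattern = ≡.cong (_∸ 1) (≡.trans (List.length-map (λ i → (i , k i)) (tabulate {n = suc L} Fin.suc))
                                              (List.length-tabulate {n = suc L} Fin.suc))

  sumK≡1+j₀+tail : sumK k ≡ suc j₀ ℕ.+ totalLength tailPattern
  sumK≡1+j₀+tail = ≡.cong₂ ℕ._+_ k₁≡1+j₀
    (≡.cong ℕ.sum (List.map-∘ {g = proj₂} {f = λ i → (i , k i)} (tabulate {n = suc L} Fin.suc)))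

  D-closed-form : z * (Q ^ L * D j₀) ≈ z ^ sumK k * G
  D-closed-form = begin
    z * (Q ^ L * D j₀)
      ≈⟨ *-congˡ {z} (*-congˡ {Q ^ L} (D-chain ℕ.≤-refl)) ⟩
    z * (Q ^ L * (z ^ j₀ * Z tailPattern))
      ≈⟨ solve 4 (λ z p a y → z :* (p :* (a :* y)) := (z :* a) :* (p :* y))
               refl z (Q ^ L) (z ^ j₀) (Z tailPattern) ⟩
    z ^ suc j₀ * (Q ^ L * Z tailPattern)
      ≈⟨ *-congˡ {z ^ suc j₀} (trans (*-congʳ {Z tailPattern} (^-congʳ Q (≡.sym length-tailPattern)))
                                     (Z-chain tailPattern-chain)) ⟩
    z ^ suc j₀ * (z ^ totalLength tailPattern * G)
      ≈⟨ *-assoc (z ^ suc j₀) (z ^ totalLength tailPattern) G ⟨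
    z ^ suc j₀ * z ^ totalLength tailPattern * G
      ≈⟨ *-congʳ {G} (trans (^-congʳ z sumK≡1+j₀+tail) (^-homo-* z (suc j₀) (totalLength tailPattern))) ⟨
    z ^ sumK k * G ∎
    where open import Relation.Binary.Reasoning.Setoid setoid

  generating-function : G * (Q ^ L * (1# - ⟦ + ℓ ⟧ * z) - (w - 1#) * z ^ sumK k) ≈ Q ^ L
  generating-function = begin
    G * (Q ^ L * (1# - ⟦ + ℓ ⟧ * z) - (w - 1#) * z ^ sumK k)
      ≈⟨ solve 7 (λ g p c z w d k →
            g :* (p :* (con (+ 1) :- c :* z) :- (w :- con (+ 1)) :* k)
            := p :* ((g :+ z :* d) :- z :* (c :* g :+ w :* d)) :+ (w :- con (+ 1)) :* (z :* (p :* d) :- k :* g))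
          refl G (Q ^ L) ⟦ + ℓ ⟧ z w (D j₀) (z ^ sumK k) ⟩
    Q ^ L * ((G + z * D j₀) - z * X) + (w - 1#) * (z * (Q ^ L * D j₀) - z ^ sumK k * G)
      ≈⟨ +-cong (*-congˡ {Q ^ L} (+-congʳ G-rec)) (*-congˡ {w - 1#} (+-congʳ D-closed-form)) ⟩
    Q ^ L * ((1# + z * X) - z * X) + (w - 1#) * (z ^ sumK k * G - z ^ sumK k * G)
      ≈⟨ solve 4 (λ p x w y → p :* ((con (+ 1) :+ x) :- x) :+ (w :- con (+ 1)) :* (y :- y) := p)
               refl (Q ^ L) (z * X) w (z ^ sumK k * G) ⟩
    Q ^ L ∎
    where
    open import Relation.Binary.Reasoning.Setoid setoid
    X = ⟦ + ℓ ⟧ * G + w * D j₀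

corollary3 : (ℓ : ℕ) → 2 ≤ ℓ → (k : Fin ℓ → ℕ) → (∀ i → 1 ≤ k i) →
    ∀ m n →
      (Gtilde ℓ k ⊛ ((((oneS ⊝ zS) ^S (ℓ ∸ 2)) ⊛ (oneS ⊝ (const (+ ℓ) ⊛ zS)))
                     ⊝ ((wS ⊝ oneS) ⊛ (zS ^S sumK k)))) m n
        ≡ ((oneS ⊝ zS) ^S (ℓ ∸ 2)) m n
corollary3 (suc (suc L)) (s≤s (s≤s z≤n)) k k-pos = begin
  Gtilde ℓ k ⊛ ((((oneS ⊝ zS) ^S L) ⊛ (oneS ⊝ (const (+ ℓ) ⊛ zS))) ⊝ ((wS ⊝ oneS) ⊛ (zS ^S sumK k)))
    ≈⟨ ⊛-≈ Gtilde≈G (⊝-≈ (⊛-≈ Q^L≈ (⊝-≈ oneS≈1# (⊛-≈ (const≈⟦⟧ (+ ℓ)) zS≈z)))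
                          (⊛-≈ (⊝-≈ wS≈w oneS≈1#) (^S≈^ zS≈z (sumK k)))) ⟩
  G * (Q ^ L * (1# - ⟦ + ℓ ⟧ * z) - (w - 1#) * z ^ sumK k)
    ≈⟨ generating-function ⟩
  Q ^ L
    ≈⟨ Q^L≈ ⟨
  (oneS ⊝ zS) ^S L ∎
  where
  open Patterns L k k-pos
  open import Relation.Binary.Reasoning.Setoid setoid
  Q^L≈ : (oneS ⊝ zS) ^S L ≈ Q ^ L
  Q^L≈ = ^S≈^ (⊝-≈ oneS≈1# zS≈z) L
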